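{- Let $P$ be a finite ranked poset with rank function $r$, let $P^*\subseteq P$ be a set of marked elements with $\min(P)\cup\max(P)\subseteq P^*$, and let $\lambda^r\colon P^*\to\mathbb{Z}$ be the marking $\lambda^r(a)=r(a)$. Then for any partition $\tilde P=P\setminus P^*=C\sqcup O$, the marked chain-order polytope $\mathcal{O}_{C,O}(P,\lambda^r)$, regarded in $\mathbb{R}^{\tilde P}$ by projecting away the fixed coordinates indexed by $P^*$, has a unique interior lattice point.
   Context: A rank function on a finite poset $P$ is a map $r\colon P\to\mathbb{Z}$ with $r(p)=r(q)-1$ for every covering relation $p\prec q$; $P$ is ranked if such a function exists. For $P^*\subseteq P$ (an induced subposet), an order-preserving $\lambda\colon P^*\to\mathbb{R}$ and a partition $P\setminus P^*=C\sqcup O$, the marked chain-order polytope $\mathcal{O}_{C,O}(P,\lambda)\subseteq\mathbb{R}^P$ is the set of all $\mathbf{x}=(x_p)_{p\in P}$ with: (1) $x_a=\lambda(a)$ for $a\in P^*$; (2) $x_p\ge0$ for $p\in C$; (3) for every saturated chain $a\prec p_1\prec\cdots\prec p_r\prec b$ with $a,b\in P^*\sqcup O$, all $p_i\in C$, $r\ge0$: $x_{p_1}+\cdots+x_{p_r}\le x_b-x_a$.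
   Formalization: The polytope $\mathcal{O}_{C,O}(P,\lambda^r)$ is taken over ℚ rather than ℝ, so its interior is tested with a rational radius and rational points. -}

module Defs where

open import Data.Nat using (ℕ)
open import Data.Fin using (Fin)
open import Data.Integer as ℤ using (ℤ)
open import Data.Rational as ℚ using (ℚ; _/_; _-_; ∣_∣)
open import Data.List using (List; []; _∷_; map; foldr)
open import Data.List.Relation.Unary.All using (All)
open import Data.Product using (Σ; _×_; ∃)
open import Data.Empty using (⊥)
open import Relation.Nullary using (¬_)
open import Relation.Binary.PropositionalEquality using (_≡_)
open import Relation.Binary.Structures using (IsPartialOrder)

record FinPoset (n : ℕ) : Set₁ where
  field
    _≼_ : Fin n → Fin n → Set
    isPartialOrder : IsPartialOrder _≡_ _≼_

module _ {n : ℕ} (P : FinPoset n) where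
  open FinPoset P

  _≺_ : Fin n → Fin n → Set
  p ≺ q = (p ≼ q) × ¬ (p ≡ q)

  Covers : Fin n → Fin n → Set
  Covers p q = (p ≺ q) × (∀ z → p ≺ z → z ≺ q → ⊥)

  IsMinimal : Fin n → Set
  IsMinimal p = ∀ q → q ≺ p → ⊥

  IsMaximal : Fin n → Set
  IsMaximal p = ∀ q → p ≺ q → ⊥

  IsRankFunction : (Fin n → ℤ) → Set
  IsRankFunction r = ∀ p q → Covers p q → r p ≡ r q ℤ.- ℤ.1ℤ

  -- Saturated chain  a ⋖ p₁ ⋖ ⋯ ⋖ p_k ⋖ b  with interior list ps = p₁ … p_k
  SatChain : Fin n → List (Fin n) → Fin n → Set
  SatChain a []       b = Covers a b
  SatChain a (p ∷ ps) b = Covers a p × SatChain p ps b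

-- Each element is marked (in P*), or an unmarked element of C, or of O.
-- This encodes P* together with a partition P \ P* = C ⊔ O.
data Kind : Set where
  marked chainC orderO : Kind

ℤ→ℚ : ℤ → ℚ
ℤ→ℚ z = z / 1

sumℚ : List ℚ → ℚ
sumℚ = foldr ℚ._+_ ℚ.0ℚ

module _ {n : ℕ} (P : FinPoset n) (kind : Fin n → Kind) (λ* : Fin n → ℚ) where

  -- x ∈ O_{C,O}(P, λ)  (λ* only matters on marked elements)
  InMCOP : (Fin n → ℚ) → Set
  InMCOP x =
      (∀ a → kind a ≡ marked → x a ≡ λ* a)
    × (∀ p → kind p ≡ chainC → ℚ.0ℚ ℚ.≤ x p)
    × (∀ a ps b → ¬ (kind a ≡ chainC) → ¬ (kind b ≡ chainC)
         → All (λ p → kind p ≡ chainC) ps → SatChain P a ps b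
         → sumℚ (map x ps) ℚ.≤ x b - x a)

  -- x lies in the interior of the polytope regarded in the coordinates of
  -- P \ P* (marked coordinates fixed to λ*): some sup-norm ball around x
  -- in the unmarked coordinates is contained in the polytope.
  -- (Tested on rational points.)
  InInterior : (Fin n → ℚ) → Set
  InInterior x =
    InMCOP x ×
    Σ ℚ (λ ε → (ℚ.0ℚ ℚ.< ε) ×
      (∀ (y : Fin n → ℚ)
         → (∀ a → kind a ≡ marked → y a ≡ λ* a)
         → (∀ p → ¬ (kind p ≡ marked) → ∣ y p - x p ∣ ℚ.< ε)
         → InMCOP y))

  IsInteriorLatticePoint : (Fin n → ℤ) → Set
  IsInteriorLatticePoint z = InInterior (λ p → ℤ→ℚ (z p))

module Submission where

open import Defs
open import Level using (0ℓ)
open import Data.Bool using (if_then_else_)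
open import Data.Nat as ℕ using (ℕ; suc)
import Data.Nat.Properties as ℕP
import Data.Nat.Coprimality as Coprime
open import Data.Fin as Fin using (Fin)
open import Data.Fin.Induction using (po-wellFounded; po-noetherian)
open import Data.Integer as ℤ using (ℤ; +_; 0ℤ; 1ℤ; _+_; _≤_)
import Data.Integer.Properties as ℤP
open import Data.Integer.Tactic.RingSolver using (solve-∀)
open import Data.Rational as ℚ using (ℚ; mkℚ)
import Data.Rational.Properties as ℚP
open import Data.Rational.Solver using (module +-*-Solver)
open import Data.List using (List; []; _∷_; map; foldr; length; _++_; allFin)
open import Data.List.Properties using (length-++; map-++)
open import Data.List.Extrema.Nat using (max; xs≤max)
open import Data.List.Membership.Propositional.Properties using (∈-map⁺; ∈-allFin)
open import Data.List.Relation.Unary.All as All using (All; []; _∷_)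
import Data.List.Relation.Unary.All.Properties as All
open import Data.Product using (Σ; _×_; _,_; proj₁; proj₂)
open import Data.Sum using (_⊎_; inj₁; inj₂)
open import Data.Empty using (⊥; ⊥-elim)
import Induction.WellFounded as WF
open import Effect.Monad using (RawMonad)
open import Relation.Nullary using (¬_; Dec; yes; no; does)
open import Relation.Nullary.Negation using (¬¬-Monad)
open import Relation.Nullary.Decidable using (decidable-stable; dec-true; dec-false)
open import Relation.Unary using (Pred; Decidable)
open import Relation.Binary.PropositionalEquality
  using (_≡_; refl; sym; trans; cong; cong₂; subst; subst₂; module ≡-Reasoning)

open RawMonad (¬¬-Monad {0ℓ}) using (_>>=_; _<$>_; _⊗_; pure)
open +-*-Solver using (solve; _:=_; _:+_; _:*_; _:-_; :-_; con)

-- The unique interior lattice point of O_{C,O}(P, λʳ) is the centre z,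
-- equal to 1 on C and to the rank r on O and on P*.
--
-- At z a chain a ⋖ p₁ ⋖ ⋯ ⋖ pₖ ⋖ b through C
-- has slack exactly 1: the rank rises by k + 1 while z sums to k.  Moving
-- every unmarked coordinate by less than ε costs at most (k + 2)ε, so with
-- ε = 1/(2M + 1), M a bound on |r|, the ε-ball around z lies in the polytope.
--
-- An interior lattice point w may be pushed by a small δ in
-- unmarked coordinates, making every inequality through an unmarked element
-- strict, hence (by integrality) of slack at least 1: w is strictly inside
-- (Perturbation, interior⇒inside).  For an unmarked p, walking down covers,
-- which exist since minimal elements are marked, through C to the first
-- non-C element gives a chain along which w ≥ r, so w p ≥ r p if p ∉ C;
-- walking up gives w p ≤ r p; for p ∈ C the joined chain is tight and
-- forces w p ≤ 1 ≤ w p (Uniqueness).  The order is not decidable, so covers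
-- exist only up to double negation; the conclusions are decidable integer
-- equalities, which makes this harmless.

sumℤ : List ℤ → ℤ
sumℤ = foldr _+_ 0ℤ

sumℤ-++ : ∀ xs ys → sumℤ (xs ++ ys) ≡ sumℤ xs + sumℤ ys
sumℤ-++ []       ys = sym (ℤP.+-identityˡ (sumℤ ys))
sumℤ-++ (x ∷ xs) ys = trans (cong (λ s → x + s) (sumℤ-++ xs ys)) (sym (ℤP.+-assoc x (sumℤ xs) (sumℤ ys)))

length≤sumℤ : ∀ {A : Set} (w : A → ℤ) xs → All (λ x → 1ℤ ≤ w x) xs
  → + length xs ≤ sumℤ (map w xs)
length≤sumℤ w []       []         = ℤP.≤-refl
length≤sumℤ w (x ∷ xs) (1≤wx ∷ h) = ℤP.+-mono-≤ 1≤wx (length≤sumℤ w xs h)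

+-cancelˡ-≤ : ∀ k {i j} → k + i ≤ k + j → i ≤ j
+-cancelˡ-≤ k {i} {j} k+i≤k+j = subst₂ _≤_ (cancel k i) (cancel k j) (ℤP.+-monoʳ-≤ (ℤ.- k) k+i≤k+j)
  where
  cancel : ∀ k x → ℤ.- k + (k + x) ≡ x
  cancel = solve-∀

+-cancelʳ-≤ : ∀ k {i j} → i + k ≤ j + k → i ≤ j
+-cancelʳ-≤ k {i} {j} i+k≤j+k = +-cancelˡ-≤ k (subst₂ _≤_ (ℤP.+-comm i k) (ℤP.+-comm j k) i+k≤j+k)

module Poset {n : ℕ} (P : FinPoset n) where
  open FinPoset P using (isPartialOrder)

  -- The order is not
  -- decidable, so the cover is only found up to double negation: if
  -- q ≺ p had no cover above it inside [q, p], neither would any z with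
  -- q ≺ z ≺ p, which is impossible by Noetherian induction on q.
  cover-below : ∀ p → ¬ IsMinimal P p → ¬ ¬ (Σ (Fin n) λ q → Covers P q p)
  cover-below p not-min no-cover = not-min (WF.All.wfRec (po-noetherian isPartialOrder) 0ℓ
    (λ q → _≺_ P q p → ⊥)
    (λ q rec q≺p → no-cover (q , q≺p , λ z q≺z z≺p → rec q≺z z≺p)))

  cover-above : ∀ p → ¬ IsMaximal P p → ¬ ¬ (Σ (Fin n) λ q → Covers P p q)
  cover-above p not-max no-cover = not-max (WF.All.wfRec (po-wellFounded isPartialOrder) 0ℓ
    (λ q → _≺_ P p q → ⊥)
    (λ q rec p≺q → no-cover (q , p≺q , λ z p≺z z≺q → rec z≺q p≺z)))

  chain-++ : ∀ a qs p qs' b → SatChain P a qs p → SatChain P p qs' b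
    → SatChain P a (qs ++ p ∷ qs') b
  chain-++ a []       p qs' b a⋖p         p→b = a⋖p , p→b
  chain-++ a (q ∷ qs) p qs' b (a⋖q , q→p) p→b = a⋖q , chain-++ q qs p qs' b q→p p→b

module Rank {n : ℕ} (P : FinPoset n) (r : Fin n → ℤ) (rank : IsRankFunction P r) where

  cover-rank : ∀ {a b} → Covers P a b → r b ≡ 1ℤ + r a
  cover-rank {a} {b} a⋖b = trans (undo-pred (r b)) (cong ℤ.suc (sym (rank a b a⋖b)))
    where
    undo-pred : ∀ x → x ≡ 1ℤ + (x ℤ.- 1ℤ)
    undo-pred = solve-∀

  chain-rank : ∀ a ps b → SatChain P a ps b → r b ≡ 1ℤ + (r a + + length ps)
  chain-rank a []       b a⋖b = trans (cover-rank a⋖b) (cong ℤ.suc (sym (ℤP.+-identityʳ (r a))))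
  chain-rank a (p ∷ ps) b (a⋖p , p→b) = begin
    r b                              ≡⟨ chain-rank p ps b p→b ⟩
    1ℤ + (r p + + length ps)         ≡⟨ cong (λ t → 1ℤ + (t + + length ps)) (cover-rank a⋖p) ⟩
    1ℤ + ((1ℤ + r a) + + length ps)  ≡⟨ cong (λ t → 1ℤ + (t + + length ps)) (ℤP.+-comm 1ℤ (r a)) ⟩
    1ℤ + ((r a + 1ℤ) + + length ps)  ≡⟨ cong ℤ.suc (ℤP.+-assoc (r a) 1ℤ (+ length ps)) ⟩
    1ℤ + (r a + (1ℤ + + length ps))  ∎
    where open ≡-Reasoning

module Kinds {n : ℕ} (kind : Fin n → Kind) where

  IsC : Fin n → Set
  IsC p = kind p ≡ chainC

  isC? : ∀ p → Dec (IsC p)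
  isC? p with kind p
  ... | chainC = yes refl
  ... | marked = no (λ ())
  ... | orderO = no (λ ())

  kind-≢ : ∀ {p k k'} → kind p ≡ k → ¬ k ≡ k' → ¬ kind p ≡ k'
  kind-≢ p∈k k≢k' p∈k' = k≢k' (trans (sym p∈k) p∈k')

  centre : (Fin n → ℤ) → Fin n → ℤ
  centre r p with kind p
  ... | chainC = 1ℤ
  ... | marked = r p
  ... | orderO = r p

  record StrictlyInside (P : FinPoset n) (r w : Fin n → ℤ) : Set where
    field
      on-marked     : ∀ a → kind a ≡ marked → w a ≡ r a
      positive-on-C : ∀ p → IsC p → 1ℤ ≤ w p
      chain-gap     : ∀ a ps b → ¬ IsC a → ¬ IsC b → All IsC ps → SatChain P a ps b
                      → 1ℤ + (w a + sumℤ (map w ps)) ≤ w b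

module Uniqueness {n : ℕ} (P : FinPoset n) (r : Fin n → ℤ) (rank : IsRankFunction P r)
  (kind : Fin n → Kind) (extremal-marked : ∀ p → IsMinimal P p ⊎ IsMaximal P p → kind p ≡ marked)
  {w : Fin n → ℤ} (inside : Kinds.StrictlyInside kind P r w) where

  open Kinds kind
  open StrictlyInside inside
  open Poset P
  open Rank P r rank

  weight : List (Fin n) → ℤ
  weight qs = sumℤ (map w qs)

  length≤weight : ∀ qs → All IsC qs → + length qs ≤ weight qs
  length≤weight qs qs∈C = length≤sumℤ w qs (All.map (positive-on-C _) qs∈C)

  LowerChain : Fin n → Set
  LowerChain p = Σ (Fin n) λ a → Σ (List (Fin n)) λ qs →
    ¬ IsC a × r a ≤ w a × All IsC qs × SatChain P a qs p

  UpperChain : Fin n → Set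
  UpperChain p = Σ (List (Fin n)) λ qs → Σ (Fin n) λ b →
    ¬ IsC b × w b ≤ r b × All IsC qs × SatChain P p qs b

  rank≤weight : ∀ p → ¬ IsC p → LowerChain p → r p ≤ w p
  rank≤weight p p∉C (a , qs , a∉C , ra≤wa , qs∈C , a→p) = begin
    r p                       ≡⟨ chain-rank a qs p a→p ⟩
    1ℤ + (r a + + length qs)  ≤⟨ ℤP.+-monoʳ-≤ 1ℤ (ℤP.+-mono-≤ ra≤wa (length≤weight qs qs∈C)) ⟩
    1ℤ + (w a + weight qs)    ≤⟨ chain-gap a qs p a∉C p∉C qs∈C a→p ⟩
    w p                       ∎
    where open ℤP.≤-Reasoning

  weight≤rank : ∀ p → ¬ IsC p → UpperChain p → w p ≤ r p
  weight≤rank p p∉C (qs , b , b∉C , wb≤rb , qs∈C , p→b) =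
    +-cancelʳ-≤ (+ length qs) (+-cancelˡ-≤ 1ℤ (begin
      1ℤ + (w p + + length qs)  ≤⟨ ℤP.+-monoʳ-≤ 1ℤ (ℤP.+-monoʳ-≤ (w p) (length≤weight qs qs∈C)) ⟩
      1ℤ + (w p + weight qs)    ≤⟨ chain-gap p qs b p∉C b∉C qs∈C p→b ⟩
      w b                       ≤⟨ wb≤rb ⟩
      r b                       ≡⟨ chain-rank p qs b p→b ⟩
      1ℤ + (r p + + length qs)  ∎))
    where open ℤP.≤-Reasoning

  tight-chain : ∀ a ps b → ¬ IsC a → ¬ IsC b → r a ≤ w a → w b ≤ r b → All IsC ps
    → SatChain P a ps b → weight ps ≤ + length ps
  tight-chain a ps b a∉C b∉C ra≤wa wb≤rb ps∈C a→b =
    +-cancelˡ-≤ (r a) (+-cancelˡ-≤ 1ℤ (begin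
      1ℤ + (r a + weight ps)    ≤⟨ ℤP.+-monoʳ-≤ 1ℤ (ℤP.+-monoˡ-≤ (weight ps) ra≤wa) ⟩
      1ℤ + (w a + weight ps)    ≤⟨ chain-gap a ps b a∉C b∉C ps∈C a→b ⟩
      w b                       ≤⟨ wb≤rb ⟩
      r b                       ≡⟨ chain-rank a ps b a→b ⟩
      1ℤ + (r a + + length ps)  ∎))
    where open ℤP.≤-Reasoning

  weight≤1 : ∀ p → IsC p → LowerChain p → UpperChain p → w p ≤ 1ℤ
  weight≤1 p p∈C (a , qs , a∉C , ra≤wa , qs∈C , a→p) (qs' , b , b∉C , wb≤rb , qs'∈C , p→b) =
    +-cancelʳ-≤ (+ length qs') (+-cancelˡ-≤ (+ length qs) (begin
      + length qs + (w p + + length qs')      ≤⟨ ℤP.+-mono-≤ (length≤weight qs qs∈C)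
                                                   (ℤP.+-monoʳ-≤ (w p) (length≤weight qs' qs'∈C)) ⟩
      weight qs + (w p + weight qs')          ≡⟨ sumℤ-++ (map w qs) (map w (p ∷ qs')) ⟨
      sumℤ (map w qs ++ map w (p ∷ qs'))      ≡⟨ cong sumℤ (map-++ w qs (p ∷ qs')) ⟨
      weight (qs ++ p ∷ qs')                  ≤⟨ tight-chain a (qs ++ p ∷ qs') b a∉C b∉C ra≤wa wb≤rb
                                                   (All.++⁺ qs∈C (p∈C ∷ qs'∈C))
                                                   (chain-++ a qs p qs' b a→p p→b) ⟩
      + length (qs ++ p ∷ qs')                ≡⟨ cong +_ (length-++ qs) ⟩
      + length qs + (1ℤ + + length qs')       ∎))
    where open ℤP.≤-Reasoning

  -- Descend along a cover q ⋖ p, which exists since p is not minimal: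
  -- through an element of C the chain is extended; at a marked element
  -- w = r; at an element of O, w ≥ r by induction.
  lower-chain : ∀ p → ¬ kind p ≡ marked → ¬ ¬ LowerChain p
  lower-chain = WF.All.wfRec (po-wellFounded (FinPoset.isPartialOrder P)) 0ℓ
    (λ p → ¬ kind p ≡ marked → ¬ ¬ LowerChain p) step
    where
    step : ∀ p → (∀ {q} → _≺_ P q p → ¬ kind q ≡ marked → ¬ ¬ LowerChain q)
      → ¬ kind p ≡ marked → ¬ ¬ LowerChain p
    step p below p-unmarked = do
      (q , q⋖p) ← cover-below p (λ p-min → p-unmarked (extremal-marked p (inj₁ p-min)))
      extend q q⋖p (below (proj₁ q⋖p))
      where
      extend : ∀ q → Covers P q p → (¬ kind q ≡ marked → ¬ ¬ LowerChain q) → ¬ ¬ LowerChain p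
      extend q q⋖p chain-to-q with kind q in q-kind
      ... | marked = pure (q , [] , kind-≢ q-kind (λ ()) ,
                           ℤP.≤-reflexive (sym (on-marked q q-kind)) , [] , q⋖p)
      ... | orderO = (λ lc → q , [] , q∉C , rank≤weight q q∉C lc , [] , q⋖p) <$> chain-to-q (λ ())
        where q∉C = kind-≢ q-kind (λ ())
      ... | chainC = (λ { (a , qs , a∉C , ra≤wa , qs∈C , a→q) →
                          a , qs ++ q ∷ [] , a∉C , ra≤wa , All.++⁺ qs∈C (q-kind ∷ []) ,
                          chain-++ a qs q [] p a→q q⋖p }) <$> chain-to-q (λ ())

  upper-chain : ∀ p → ¬ kind p ≡ marked → ¬ ¬ UpperChain p
  upper-chain = WF.All.wfRec (po-noetherian (FinPoset.isPartialOrder P)) 0ℓ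
    (λ p → ¬ kind p ≡ marked → ¬ ¬ UpperChain p) step
    where
    step : ∀ p → (∀ {q} → _≺_ P p q → ¬ kind q ≡ marked → ¬ ¬ UpperChain q)
      → ¬ kind p ≡ marked → ¬ ¬ UpperChain p
    step p above p-unmarked = do
      (q , p⋖q) ← cover-above p (λ p-max → p-unmarked (extremal-marked p (inj₂ p-max)))
      extend q p⋖q (above (proj₁ p⋖q))
      where
      extend : ∀ q → Covers P p q → (¬ kind q ≡ marked → ¬ ¬ UpperChain q) → ¬ ¬ UpperChain p
      extend q p⋖q chain-from-q with kind q in q-kind
      ... | marked = pure ([] , q , kind-≢ q-kind (λ ()) ,
                           ℤP.≤-reflexive (on-marked q q-kind) , [] , p⋖q)
      ... | orderO = (λ uc → [] , q , q∉C , weight≤rank q q∉C uc , [] , p⋖q) <$> chain-from-q (λ ())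
        where q∉C = kind-≢ q-kind (λ ())
      ... | chainC = (λ { (qs , b , b∉C , wb≤rb , qs∈C , q→b) →
                          q ∷ qs , b , b∉C , wb≤rb , q-kind ∷ qs∈C , p⋖q , q→b }) <$> chain-from-q (λ ())

  inside⇒centre : ∀ p → w p ≡ centre r p
  inside⇒centre p with kind p in p-kind
  ... | marked = on-marked p p-kind
  ... | orderO = decidable-stable (w p ℤP.≟ r p)
        ((λ (lc , uc) → ℤP.≤-antisym (weight≤rank p p∉C uc) (rank≤weight p p∉C lc))
          <$> (lower-chain p p-unmarked ⊗ upper-chain p p-unmarked))
    where
    p∉C = kind-≢ p-kind (λ ())
    p-unmarked = kind-≢ p-kind (λ ())
  ... | chainC = decidable-stable (w p ℤP.≟ 1ℤ)
        ((λ (lc , uc) → ℤP.≤-antisym (weight≤1 p p-kind lc uc) (positive-on-C p p-kind))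
          <$> (lower-chain p p-unmarked ⊗ upper-chain p p-unmarked))
    where p-unmarked = kind-≢ p-kind (λ ())

ι : ℤ → ℚ
ι = ℤ→ℚ

-- ι i written as the normalised fraction i/1, whose numerator and
-- denominator compute.
fraction : ℤ → ℚ
fraction i = mkℚ i 0 (Coprime.sym (Coprime.1-coprimeTo ℤ.∣ i ∣))

ι≡fraction : ∀ i → ι i ≡ fraction i
ι≡fraction i = ℚP.↥p/↧p≡p (fraction i)

ι-mono-≤ : ∀ {i j} → i ≤ j → ι i ℚ.≤ ι j
ι-mono-≤ {i} {j} i≤j rewrite ι≡fraction i | ι≡fraction j =
  ℚ.*≤* (subst₂ _≤_ (sym (ℤP.*-identityʳ i)) (sym (ℤP.*-identityʳ j)) i≤j)

ι-cancel-< : ∀ {i j} → ι i ℚ.< ι j → i ℤ.< j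
ι-cancel-< {i} {j} ιi<ιj rewrite ι≡fraction i | ι≡fraction j with ιi<ιj
... | ℚ.*<* i*1<j*1 = subst₂ ℤ._<_ (ℤP.*-identityʳ i) (ℤP.*-identityʳ j) i*1<j*1

ι-injective : ∀ {i j} → ι i ≡ ι j → i ≡ j
ι-injective {i} {j} ιi≡ιj = proj₁ (ℚP.mkℚ-injective (trans (sym (ι≡fraction i)) (trans ιi≡ιj (ι≡fraction j))))

ι-+ : ∀ i j → ι (i + j) ≡ ι i ℚ.+ ι j
ι-+ i j rewrite ι≡fraction i | ι≡fraction j =
  ℚP./-cong {q₁ = 1} {q₂ = 1} (cong₂ _+_ (sym (ℤP.*-identityʳ i)) (sym (ℤP.*-identityʳ j))) refl

ι-sum : ∀ {A : Set} (w : A → ℤ) xs → ι (sumℤ (map w xs)) ≡ sumℚ (map (λ x → ι (w x)) xs)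
ι-sum w []       = refl
ι-sum w (x ∷ xs) = trans (ι-+ (w x) _) (cong (λ s → ι (w x) ℚ.+ s) (ι-sum w xs))

0≤v-u⇒u≤v : ∀ {u v} → ℚ.0ℚ ℚ.≤ v ℚ.- u → u ℚ.≤ v
0≤v-u⇒u≤v {u} {v} 0≤v-u = subst₂ ℚ._≤_ (ℚP.+-identityˡ u) (cancel v u) (ℚP.+-monoˡ-≤ u 0≤v-u)
  where
  cancel : ∀ v u → (v ℚ.- u) ℚ.+ u ≡ v
  cancel = solve 2 (λ v u → (v :- u) :+ u := v) refl

u≤v⇒0≤v-u : ∀ {u v} → u ℚ.≤ v → ℚ.0ℚ ℚ.≤ v ℚ.- u
u≤v⇒0≤v-u {u} {v} u≤v = subst (ℚ._≤ v ℚ.- u) (ℚP.+-inverseʳ u) (ℚP.+-monoˡ-≤ (ℚ.- u) u≤v)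

p≤p+q : ∀ p {q} → ℚ.0ℚ ℚ.≤ q → p ℚ.≤ p ℚ.+ q
p≤p+q p 0≤q = subst (ℚ._≤ p ℚ.+ _) (ℚP.+-identityʳ p) (ℚP.+-monoʳ-≤ p 0≤q)

gap⇒< : ∀ {u s v δ} → ℚ.0ℚ ℚ.< δ → s ℚ.+ δ ℚ.≤ v ℚ.- u → u ℚ.+ s ℚ.< v
gap⇒< {u} {s} {v} {δ} 0<δ s+δ≤v-u = begin-strict
  u ℚ.+ s                ≡⟨ ℚP.+-identityʳ (u ℚ.+ s) ⟨
  (u ℚ.+ s) ℚ.+ ℚ.0ℚ     <⟨ ℚP.+-monoʳ-< (u ℚ.+ s) 0<δ ⟩
  (u ℚ.+ s) ℚ.+ δ        ≡⟨ ℚP.+-assoc u s δ ⟩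
  u ℚ.+ (s ℚ.+ δ)        ≤⟨ ℚP.+-monoʳ-≤ u s+δ≤v-u ⟩
  u ℚ.+ (v ℚ.- u)        ≡⟨ solve 2 (λ u v → u :+ (v :- u) := v) refl u v ⟩
  v                      ∎
  where open ℚP.≤-Reasoning

p≤∣p∣ : ∀ p → p ℚ.≤ ℚ.∣ p ∣
p≤∣p∣ p with ℚP.≤-total ℚ.0ℚ p
... | inj₁ 0≤p = ℚP.≤-reflexive (sym (ℚP.0≤p⇒∣p∣≡p 0≤p))
... | inj₂ p≤0 = ℚP.≤-trans p≤0 (ℚP.0≤∣p∣ p)

∣-∣≤⇒≤+ : ∀ {u v e} → ℚ.∣ u ℚ.- v ∣ ℚ.≤ e → u ℚ.≤ v ℚ.+ e
∣-∣≤⇒≤+ {u} {v} {e} ∣u-v∣≤e = begin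
  u                  ≡⟨ solve 2 (λ u v → u := v :+ (u :- v)) refl u v ⟩
  v ℚ.+ (u ℚ.- v)    ≤⟨ ℚP.+-monoʳ-≤ v (ℚP.≤-trans (p≤∣p∣ (u ℚ.- v)) ∣u-v∣≤e) ⟩
  v ℚ.+ e            ∎
  where open ℚP.≤-Reasoning

∣-∣≤⇒-≤ : ∀ {u v e} → ℚ.∣ u ℚ.- v ∣ ℚ.≤ e → v ℚ.- e ℚ.≤ u
∣-∣≤⇒-≤ {u} {v} {e} ∣u-v∣≤e = begin
  v ℚ.- e                      ≤⟨ ℚP.+-monoˡ-≤ (ℚ.- e) (∣-∣≤⇒≤+ {v} {u} ∣v-u∣≤e) ⟩
  (u ℚ.+ e) ℚ.- e              ≡⟨ solve 2 (λ u e → (u :+ e) :- e := u) refl u e ⟩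
  u                            ∎
  where
  open ℚP.≤-Reasoning
  ∣v-u∣≤e : ℚ.∣ v ℚ.- u ∣ ℚ.≤ e
  ∣v-u∣≤e = subst (ℚ._≤ e)
    (trans (cong ℚ.∣_∣ (solve 2 (λ u v → u :- v := :- (v :- u)) refl u v)) (ℚP.∣-p∣≡∣p∣ (v ℚ.- u)))
    ∣u-v∣≤e

sumℚ-mono : ∀ {A : Set} (f g : A → ℚ) xs → All (λ x → f x ℚ.≤ g x) xs
  → sumℚ (map f xs) ℚ.≤ sumℚ (map g xs)
sumℚ-mono f g []       []           = ℚP.≤-refl
sumℚ-mono f g (x ∷ xs) (fx≤gx ∷ h) = ℚP.+-mono-≤ fx≤gx (sumℚ-mono f g xs h)

sumℚ-const : ∀ {A : Set} (c : ℚ) (xs : List A) → sumℚ (map (λ _ → c) xs) ≡ ι (+ length xs) ℚ.* c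
sumℚ-const c []       = sym (ℚP.*-zeroˡ c)
sumℚ-const c (x ∷ xs) = begin
  c ℚ.+ sumℚ (map (λ _ → c) xs)      ≡⟨ cong (c ℚ.+_) (sumℚ-const c xs) ⟩
  c ℚ.+ ι (+ length xs) ℚ.* c        ≡⟨ solve 2 (λ c k → c :+ k :* c := (con ℚ.1ℚ :+ k) :* c) refl c (ι (+ length xs)) ⟩
  (ℚ.1ℚ ℚ.+ ι (+ length xs)) ℚ.* c   ≡⟨ cong (ℚ._* c) (ι-+ 1ℤ (+ length xs)) ⟨
  ι (+ length (x ∷ xs)) ℚ.* c        ∎
  where open ≡-Reasoning

-- Interior points in the rational coordinates: perturbing an interior
-- point x by a small amount in unmarked coordinates stays inside the
-- polytope, which turns every inequality through an unmarked element
-- into a strict one.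
module Perturbation {n : ℕ} (P : FinPoset n) (kind : Fin n → Kind) (λ* : Fin n → ℚ)
  {x : Fin n → ℚ} (interior : InInterior P kind λ* x) where

  open Kinds kind using (IsC; isC?; kind-≢)

  ε : ℚ
  ε = proj₁ (proj₂ interior)

  0<ε : ℚ.0ℚ ℚ.< ε
  0<ε = proj₁ (proj₂ (proj₂ interior))

  δ : ℚ
  δ = proj₁ (ℚP.<-dense 0<ε)

  0<δ : ℚ.0ℚ ℚ.< δ
  0<δ = proj₁ (proj₂ (ℚP.<-dense 0<ε))

  ∣δ∣<ε : ℚ.∣ δ ∣ ℚ.< ε
  ∣δ∣<ε = subst (ℚ._< ε) (sym (ℚP.0≤p⇒∣p∣≡p (ℚP.<⇒≤ 0<δ))) (proj₂ (proj₂ (ℚP.<-dense 0<ε)))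

  ∣-δ∣<ε : ℚ.∣ ℚ.- δ ∣ ℚ.< ε
  ∣-δ∣<ε = subst (ℚ._< ε) (sym (ℚP.∣-p∣≡∣p∣ δ)) ∣δ∣<ε

  shift : ∀ {Q : Pred (Fin n) 0ℓ} → Decidable Q → ℚ → Fin n → ℚ
  shift Q? t q = if does (Q? q) then x q ℚ.+ t else x q

  shift-in : ∀ {Q : Pred (Fin n) 0ℓ} (Q? : Decidable Q) t {q} → Q q → shift Q? t q ≡ x q ℚ.+ t
  shift-in Q? t {q} Qq rewrite dec-true (Q? q) Qq = refl

  shift-out : ∀ {Q : Pred (Fin n) 0ℓ} (Q? : Decidable Q) t {q} → ¬ Q q → shift Q? t q ≡ x q
  shift-out Q? t {q} ¬Qq rewrite dec-false (Q? q) ¬Qq = refl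

  shift-feasible : ∀ {Q : Pred (Fin n) 0ℓ} (Q? : Decidable Q) t → ℚ.∣ t ∣ ℚ.< ε
    → (∀ a → kind a ≡ marked → ¬ Q a) → InMCOP P kind λ* (shift Q? t)
  shift-feasible Q? t ∣t∣<ε unmoved = proj₂ (proj₂ (proj₂ interior)) (shift Q? t) fixed moved
    where
    fixed : ∀ a → kind a ≡ marked → shift Q? t a ≡ λ* a
    fixed a a-marked = trans (shift-out Q? t (unmoved a a-marked)) (proj₁ (proj₁ interior) a a-marked)
    moved : ∀ q → ¬ kind q ≡ marked → ℚ.∣ shift Q? t q ℚ.- x q ∣ ℚ.< ε
    moved q _ with Q? q
    ... | yes _ = subst (ℚ._< ε) (cong ℚ.∣_∣ (solve 2 (λ a t → t := (a :+ t) :- a) refl (x q) t)) ∣t∣<ε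
    ... | no  _ = subst (ℚ._< ε) (cong ℚ.∣_∣ (sym (ℚP.+-inverseʳ (x q)))) 0<ε

  -- Every element of C is strictly positive: lower it by δ.
  positive-on-C : ∀ p → IsC p → ℚ.0ℚ ℚ.< x p
  positive-on-C p p∈C = ℚP.<-≤-trans 0<δ (0≤v-u⇒u≤v 0≤xp-δ)
    where
    lowered = shift-feasible {Q = _≡ p} (Fin._≟ p) (ℚ.- δ) ∣-δ∣<ε
      (λ a a-marked a≡p → kind-≢ a-marked (λ ()) (subst IsC (sym a≡p) p∈C))
    0≤xp-δ : ℚ.0ℚ ℚ.≤ x p ℚ.- δ
    0≤xp-δ = subst (ℚ.0ℚ ℚ.≤_) (shift-in (Fin._≟ p) (ℚ.- δ) refl) (proj₁ (proj₂ lowered) p p∈C)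

  -- A cover a ⋖ b into an element of O is strict: lower b by δ.
  strict-cover-into-O : ∀ {a b} → Covers P a b → ¬ IsC a → kind b ≡ orderO
    → x a ℚ.+ ℚ.0ℚ ℚ.< x b
  strict-cover-into-O {a} {b} a⋖b a∉C b∈O =
    gap⇒< 0<δ (subst (ℚ._≤ x b ℚ.- x a) (sym (ℚP.+-identityˡ δ)) (0≤v-u⇒u≤v (begin
      ℚ.0ℚ                                           ≤⟨ proj₂ (proj₂ lowered) a [] b a∉C b∉C [] a⋖b ⟩
      shift (Fin._≟ b) (ℚ.- δ) b ℚ.- shift (Fin._≟ b) (ℚ.- δ) a
        ≡⟨ cong₂ ℚ._-_ (shift-in (Fin._≟ b) (ℚ.- δ) refl) (shift-out (Fin._≟ b) (ℚ.- δ) (proj₂ (proj₁ a⋖b))) ⟩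
      (x b ℚ.- δ) ℚ.- x a                            ≡⟨ solve 3 (λ a b d → (b :- d) :- a := (b :- a) :- d) refl (x a) (x b) δ ⟩
      (x b ℚ.- x a) ℚ.- δ                            ∎)))
    where
    open ℚP.≤-Reasoning
    b∉C = kind-≢ b∈O (λ ())
    lowered = shift-feasible {Q = _≡ b} (Fin._≟ b) (ℚ.- δ) ∣-δ∣<ε
      (λ a' a'-marked a'≡b → kind-≢ a'-marked (λ ()) (subst (λ q → kind q ≡ orderO) (sym a'≡b) b∈O))

  -- A cover a ⋖ b out of an element of O is strict: raise a by δ.
  strict-cover-from-O : ∀ {a b} → Covers P a b → kind a ≡ orderO → ¬ IsC b
    → x a ℚ.+ ℚ.0ℚ ℚ.< x b
  strict-cover-from-O {a} {b} a⋖b a∈O b∉C =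
    gap⇒< 0<δ (subst (ℚ._≤ x b ℚ.- x a) (sym (ℚP.+-identityˡ δ)) (0≤v-u⇒u≤v (begin
      ℚ.0ℚ                                           ≤⟨ proj₂ (proj₂ raised) a [] b a∉C b∉C [] a⋖b ⟩
      shift (Fin._≟ a) δ b ℚ.- shift (Fin._≟ a) δ a
        ≡⟨ cong₂ ℚ._-_ (shift-out (Fin._≟ a) δ (λ b≡a → proj₂ (proj₁ a⋖b) (sym b≡a))) (shift-in (Fin._≟ a) δ refl) ⟩
      x b ℚ.- (x a ℚ.+ δ)                            ≡⟨ solve 3 (λ a b d → b :- (a :+ d) := (b :- a) :- d) refl (x a) (x b) δ ⟩
      (x b ℚ.- x a) ℚ.- δ                            ∎)))
    where
    open ℚP.≤-Reasoning
    a∉C = kind-≢ a∈O (λ ())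
    raised = shift-feasible {Q = _≡ a} (Fin._≟ a) δ ∣δ∣<ε
      (λ a' a'-marked a'≡a → kind-≢ a'-marked (λ ()) (subst (λ q → kind q ≡ orderO) (sym a'≡a) a∈O))

  -- A chain through a nonempty part of C is strict: raise all of C by δ.
  strict-chain-through-C : ∀ a q qs b → ¬ IsC a → ¬ IsC b → All IsC (q ∷ qs) → SatChain P a (q ∷ qs) b
    → x a ℚ.+ sumℚ (map x (q ∷ qs)) ℚ.< x b
  strict-chain-through-C a q qs b a∉C b∉C ps∈C@(q∈C ∷ qs∈C) a→b = gap⇒< 0<δ (begin
    sumℚ (map x (q ∷ qs)) ℚ.+ δ        ≡⟨ solve 3 (λ q s d → (q :+ s) :+ d := (q :+ d) :+ s) refl (x q) (sumℚ (map x qs)) δ ⟩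
    (x q ℚ.+ δ) ℚ.+ sumℚ (map x qs)    ≤⟨ ℚP.+-mono-≤ (ℚP.≤-reflexive (sym (shift-in isC? δ q∈C)))
                                           (sumℚ-mono x y qs (All.map (λ {q'} q'∈C → raised-≥ q' q'∈C) qs∈C)) ⟩
    sumℚ (map y (q ∷ qs))              ≤⟨ proj₂ (proj₂ feasible) a (q ∷ qs) b a∉C b∉C ps∈C a→b ⟩
    y b ℚ.- y a                        ≡⟨ cong₂ ℚ._-_ (shift-out isC? δ b∉C) (shift-out isC? δ a∉C) ⟩
    x b ℚ.- x a                        ∎)
    where
    open ℚP.≤-Reasoning
    y = shift isC? δ
    feasible = shift-feasible isC? δ ∣δ∣<ε (λ a a-marked → kind-≢ a-marked (λ ()))
    raised-≥ : ∀ q → IsC q → x q ℚ.≤ y q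
    raised-≥ q q∈C = subst (x q ℚ.≤_) (sym (shift-in isC? δ q∈C)) (p≤p+q (x q) (ℚP.<⇒≤ 0<δ))

interior⇒inside : ∀ {n} (P : FinPoset n) (r : Fin n → ℤ) → IsRankFunction P r → (kind : Fin n → Kind)
  → ∀ {w} → IsInteriorLatticePoint P kind (λ a → ι (r a)) w → Kinds.StrictlyInside kind P r w
interior⇒inside P r rank kind {w} interior = record
  { on-marked     = on-marked
  ; positive-on-C = λ p p∈C → ℤP.i<j⇒suc[i]≤j (ι-cancel-< {0ℤ} {w p} (positive-on-C p p∈C))
  ; chain-gap     = chain-gap
  }
  where
  open Kinds kind using (IsC; kind-≢)
  open Perturbation P kind (λ a → ι (r a)) interior
  open Rank P r rank using (cover-rank)

  on-marked : ∀ a → kind a ≡ marked → w a ≡ r a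
  on-marked a a-marked = ι-injective (proj₁ (proj₁ interior) a a-marked)

  -- Strictness over ℚ gives slack at least 1 over ℤ.
  gap : ∀ a ps b → ι (w a) ℚ.+ sumℚ (map (λ q → ι (w q)) ps) ℚ.< ι (w b)
    → 1ℤ + (w a + sumℤ (map w ps)) ≤ w b
  gap a ps b strict = ℤP.i<j⇒suc[i]≤j (ι-cancel-< {w a + sumℤ (map w ps)} (subst (ℚ._< ι (w b))
    (sym (trans (ι-+ (w a) _) (cong (ι (w a) ℚ.+_) (ι-sum w ps)))) strict))

  chain-gap : ∀ a ps b → ¬ IsC a → ¬ IsC b → All IsC ps → SatChain P a ps b
    → 1ℤ + (w a + sumℤ (map w ps)) ≤ w b
  chain-gap a (q ∷ qs) b a∉C b∉C ps∈C a→b = gap a (q ∷ qs) b (strict-chain-through-C a q qs b a∉C b∉C ps∈C a→b)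
  chain-gap a []       b a∉C b∉C []   a⋖b with kind b in b-kind | kind a in a-kind
  ... | chainC | _      = ⊥-elim (b∉C refl)
  ... | orderO | _      = gap a [] b (strict-cover-into-O a⋖b (kind-≢ a-kind a∉C) b-kind)
  ... | marked | chainC = ⊥-elim (a∉C refl)
  ... | marked | orderO = gap a [] b (strict-cover-from-O a⋖b a-kind (kind-≢ b-kind (λ ())))
  ... | marked | marked = ℤP.≤-reflexive (begin
    1ℤ + (w a + 0ℤ)  ≡⟨ cong ℤ.suc (ℤP.+-identityʳ (w a)) ⟩
    1ℤ + w a         ≡⟨ cong ℤ.suc (on-marked a a-kind) ⟩
    1ℤ + r a         ≡⟨ cover-rank a⋖b ⟨
    r b              ≡⟨ on-marked b b-kind ⟨
    w b              ∎)
    where open ≡-Reasoning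

-- The centre of O_{C,O}(P, r) is an interior lattice point: the ball of
-- radius ε = 1/(2M+1) around it, M bounding |r|, lies in the polytope,
-- since every chain inequality has slack 1 at the centre while a chain
-- of k elements of C moves both sides by at most (k + 2)ε ≤ 1.
module CentreInterior {n : ℕ} (P : FinPoset n) (r : Fin n → ℤ) (rank : IsRankFunction P r)
  (kind : Fin n → Kind) where

  open Kinds kind
  open Rank P r rank using (chain-rank)

  centre-on-C : ∀ p → IsC p → centre r p ≡ 1ℤ
  centre-on-C p p∈C with kind p
  ... | chainC = refl

  centre-off-C : ∀ p → ¬ IsC p → centre r p ≡ r p
  centre-off-C p p∉C with kind p
  ... | chainC = ⊥-elim (p∉C refl)
  ... | marked = refl
  ... | orderO = refl

  M : ℕ
  M = max 0 (map (λ p → ℤ.∣ r p ∣) (allFin n))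

  ∣r∣≤M : ∀ p → ℤ.∣ r p ∣ ℕ.≤ M
  ∣r∣≤M p = All.lookup (xs≤max 0 (map (λ p → ℤ.∣ r p ∣) (allFin n))) (∈-map⁺ (λ p → ℤ.∣ r p ∣) (∈-allFin p))

  -- Saturated chains are short, since the rank grows along them.
  chain-length : ∀ a ps b → SatChain P a ps b → suc (length ps) ℕ.≤ M ℕ.+ M
  chain-length a ps b a→b = begin
    suc (length ps)           ≡⟨ cong ℤ.∣_∣ rank-difference ⟨
    ℤ.∣ r b ℤ.- r a ∣         ≤⟨ ℤP.∣i-j∣≤∣i∣+∣j∣ (r b) (r a) ⟩
    ℤ.∣ r b ∣ ℕ.+ ℤ.∣ r a ∣   ≤⟨ ℕP.+-mono-≤ (∣r∣≤M b) (∣r∣≤M a) ⟩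
    M ℕ.+ M                   ∎
    where
    open ℕP.≤-Reasoning
    rank-difference : r b ℤ.- r a ≡ 1ℤ + + length ps
    rank-difference = trans (cong (ℤ._- r a) (chain-rank a ps b a→b)) (cancel (r a) (+ length ps))
      where
      cancel : ∀ x k → (1ℤ + (x + k)) ℤ.- x ≡ 1ℤ + k
      cancel = solve-∀

  -- ε = 1/N with N = 2M + 1 exceeds k + 2 for every chain of k elements.
  N : ℕ
  N = suc (M ℕ.+ M)

  ε : ℚ
  ε = ℚ.1/ fraction (+ N)

  instance
    ε-positive : ℚ.Positive ε
    ε-positive = ℚP.1/pos⇒pos (fraction (+ N))

    ε-nonNegative : ℚ.NonNegative ε
    ε-nonNegative = ℚP.pos⇒nonNeg ε

  0<ε : ℚ.0ℚ ℚ.< ε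
  0<ε = ℚP.positive⁻¹ ε

  scaled-ε≤1 : ∀ m → m ℕ.≤ N → ι (+ m) ℚ.* ε ℚ.≤ ℚ.1ℚ
  scaled-ε≤1 m m≤N = begin
    ι (+ m) ℚ.* ε            ≤⟨ ℚP.*-monoʳ-≤-nonNeg ε (ι-mono-≤ (ℤ.+≤+ m≤N)) ⟩
    ι (+ N) ℚ.* ε            ≡⟨ cong (ℚ._* ε) (ι≡fraction (+ N)) ⟩
    fraction (+ N) ℚ.* ε     ≡⟨ ℚP.*-inverseʳ (fraction (+ N)) ⟩
    ℚ.1ℚ                     ∎
    where open ℚP.≤-Reasoning

  λr : Fin n → ℚ
  λr a = ι (r a)

  module Ball (y : Fin n → ℚ) (fixed : ∀ a → kind a ≡ marked → y a ≡ λr a)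
    (close : ∀ p → ¬ kind p ≡ marked → ℚ.∣ y p ℚ.- ι (centre r p) ∣ ℚ.< ε) where

    near : ∀ q → ℚ.∣ y q ℚ.- ι (centre r q) ∣ ℚ.≤ ε
    near q with kind q in q-kind | close q
    ... | marked | _ = subst (λ v → ℚ.∣ v ℚ.- ι (r q) ∣ ℚ.≤ ε) (sym (fixed q q-kind))
                     (subst (ℚ._≤ ε) (cong ℚ.∣_∣ (sym (ℚP.+-inverseʳ (ι (r q))))) (ℚP.<⇒≤ 0<ε))
    ... | chainC | close-q = ℚP.<⇒≤ (close-q (λ ()))
    ... | orderO | close-q = ℚP.<⇒≤ (close-q (λ ()))

    below : ∀ q → ι (centre r q) ℚ.- ε ℚ.≤ y q
    below q = ∣-∣≤⇒-≤ (near q)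

    above : ∀ q → y q ℚ.≤ ι (centre r q) ℚ.+ ε
    above q = ∣-∣≤⇒≤+ (near q)

    nonnegative : ∀ p → IsC p → ℚ.0ℚ ℚ.≤ y p
    nonnegative p p∈C = ℚP.≤-trans (u≤v⇒0≤v-u ε≤1)
      (subst (λ v → ι v ℚ.- ε ℚ.≤ y p) (centre-on-C p p∈C) (below p))
      where
      ε≤1 : ε ℚ.≤ ℚ.1ℚ
      ε≤1 = subst (ℚ._≤ ℚ.1ℚ) (ℚP.*-identityˡ ε) (scaled-ε≤1 1 (ℕ.s≤s ℕ.z≤n))

    -- Along a chain through C, y gains at most (k + 2)ε ≤ 1 on the slack 1 of the centre.
    chain-inequality : ∀ a ps b → ¬ IsC a → ¬ IsC b → All IsC ps → SatChain P a ps b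
      → sumℚ (map y ps) ℚ.≤ y b ℚ.- y a
    chain-inequality a ps b a∉C b∉C ps∈C a→b = begin
      sumℚ (map y ps)                                  ≤⟨ sumℚ-mono y (λ _ → ℚ.1ℚ ℚ.+ ε) ps (All.map (λ {q} → above-1 q) ps∈C) ⟩
      sumℚ (map (λ _ → ℚ.1ℚ ℚ.+ ε) ps)                 ≡⟨ sumℚ-const (ℚ.1ℚ ℚ.+ ε) ps ⟩
      K ℚ.* (ℚ.1ℚ ℚ.+ ε)                               ≤⟨ p≤p+q (K ℚ.* (ℚ.1ℚ ℚ.+ ε)) (u≤v⇒0≤v-u short) ⟩
      K ℚ.* (ℚ.1ℚ ℚ.+ ε) ℚ.+ (ℚ.1ℚ ℚ.- (ℚ.1ℚ ℚ.+ (ℚ.1ℚ ℚ.+ K)) ℚ.* ε)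
        ≡⟨ solve 3 (λ R K e → K :* (con ℚ.1ℚ :+ e) :+ (con ℚ.1ℚ :- (con ℚ.1ℚ :+ (con ℚ.1ℚ :+ K)) :* e)
                          := ((con ℚ.1ℚ :+ (R :+ K)) :- e) :- (R :+ e)) refl R K ε ⟩
      ((ℚ.1ℚ ℚ.+ (R ℚ.+ K)) ℚ.- ε) ℚ.- (R ℚ.+ ε)      ≡⟨ cong₂ (λ u v → (u ℚ.- ε) ℚ.- (v ℚ.+ ε)) centre-b centre-a ⟨
      (ι (centre r b) ℚ.- ε) ℚ.- (ι (centre r a) ℚ.+ ε) ≤⟨ ℚP.+-mono-≤ (below b) (ℚP.neg-antimono-≤ (above a)) ⟩
      y b ℚ.- y a                                      ∎
      where
      open ℚP.≤-Reasoning
      K = ι (+ length ps)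
      R = ι (r a)
      above-1 : ∀ q → IsC q → y q ℚ.≤ ℚ.1ℚ ℚ.+ ε
      above-1 q q∈C = subst (λ v → y q ℚ.≤ ι v ℚ.+ ε) (centre-on-C q q∈C) (above q)
      centre-a : ι (centre r a) ≡ R
      centre-a = cong ι (centre-off-C a a∉C)
      centre-b : ι (centre r b) ≡ ℚ.1ℚ ℚ.+ (R ℚ.+ K)
      centre-b = trans (cong ι (trans (centre-off-C b b∉C) (chain-rank a ps b a→b)))
                       (trans (ι-+ 1ℤ (r a + + length ps)) (cong (ℚ.1ℚ ℚ.+_) (ι-+ (r a) (+ length ps))))
      short : (ℚ.1ℚ ℚ.+ (ℚ.1ℚ ℚ.+ K)) ℚ.* ε ℚ.≤ ℚ.1ℚ
      short = subst (λ v → v ℚ.* ε ℚ.≤ ℚ.1ℚ) (trans (ι-+ 1ℤ (1ℤ + + length ps)) (cong (ℚ.1ℚ ℚ.+_) (ι-+ 1ℤ (+ length ps))))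
                (scaled-ε≤1 (suc (suc (length ps))) (ℕ.s≤s (chain-length a ps b a→b)))

  ball : ∀ y → (∀ a → kind a ≡ marked → y a ≡ λr a)
    → (∀ p → ¬ kind p ≡ marked → ℚ.∣ y p ℚ.- ι (centre r p) ∣ ℚ.< ε)
    → InMCOP P kind λr y
  ball y fixed close = fixed , nonnegative , chain-inequality
    where open Ball y fixed close

  centre-interior : IsInteriorLatticePoint P kind λr (centre r)
  centre-interior = ball (λ p → ι (centre r p)) fixed centred , ε , 0<ε , ball
    where
    fixed : ∀ a → kind a ≡ marked → ι (centre r a) ≡ λr a
    fixed a a-marked = cong ι (centre-off-C a (kind-≢ a-marked (λ ())))
    centred : ∀ p → ¬ kind p ≡ marked → ℚ.∣ ι (centre r p) ℚ.- ι (centre r p) ∣ ℚ.< ε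
    centred p _ = subst (ℚ._< ε) (cong ℚ.∣_∣ (sym (ℚP.+-inverseʳ (ι (centre r p))))) 0<ε

corollary3p2 : (n : ℕ) (P : FinPoset n) (r : Fin n → ℤ) → IsRankFunction P r
    → (kind : Fin n → Kind)
    → (∀ p → IsMinimal P p ⊎ IsMaximal P p → kind p ≡ marked)
    → Σ (Fin n → ℤ) (λ z → IsInteriorLatticePoint P kind (λ a → ℤ→ℚ (r a)) z
        × (∀ w → IsInteriorLatticePoint P kind (λ a → ℤ→ℚ (r a)) w
             → ∀ p → w p ≡ z p))
corollary3p2 n P r rank kind extremal-marked =
  centre r , centre-interior , λ w interior → inside⇒centre (interior⇒inside P r rank kind interior)
  where
  open Kinds kind using (centre)
  open CentreInterior P r rank kind using (centre-interior)
  open Uniqueness P r rank kind extremal-marked using (inside⇒centre)
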